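{- Let $M$ be a connected simple matroid of rank $3$ on $E$ with rank function $r$, and let $\mathcal{F}^2(M)$ be the set of subsets $F\subseteq E$ with $r(F)=2$ such that $(F,2)_\le$ is a facet-defining inequality of $\mathcal{B}(M)$. If there exist distinct $x,y\in E$ such that $\{F\in\mathcal{F}^2(M):x\in F\}=\{F\in\mathcal{F}^2(M):y\in F\}$ and $r(E\setminus\{x,y\})=3$, then $\mathcal{B}(M)$ is 2-decomposable by the hyperplane $(\{x,y\},1)_=$.
   Context: For $A\subseteq E$ and integer $a$, $(A,a)_\le=\{I\subseteq E:|I\cap A|\le a\}$ and similarly $(A,a)_\ge,(A,a)_<,(A,a)_>,(A,a)_=$. $\mathcal{B}(M)$ is the family of bases. A face of $\mathcal{B}(M)$ is $\mathcal{B}(M)\cap\bigcap_i(A_i,r(A_i))_=$; a facet is a maximal proper face; $(F,r(F))_\le$ is facet-defining if $\mathcal{B}(M)\cap(F,r(F))_=$ is a facet. $\mathcal{B}(M)$ is 2-decomposable by $(A,a)_=$ if $\mathcal{B}(M)\cap(A,a)_\ge$ and $\mathcal{B}(M)\cap(A,a)_\le$ are both base families of matroids on $E$ and $\mathcal{B}(M)\cap(A,a)_>$, $\mathcal{B}(M)\cap(A,a)_<$ are both non-empty. -}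

module Defs where

open import Data.Nat using (ℕ; _≤_; _<_; _+_; _≤ᵇ_; _<ᵇ_; _≡ᵇ_)
open import Data.Bool using (Bool; true; false; _∧_)
open import Data.Fin using (Fin)
open import Data.Fin.Subset using (Subset; _∈_; _∉_; _∩_; _∪_; ∁; ⁅_⁆; _-_; ∣_∣; ⊥; ⊤)
open import Data.List using (List; []; _∷_)
open import Data.Product using (Σ; _×_; ∃; ∃-syntax; _,_)
open import Relation.Binary.PropositionalEquality using (_≡_; _≢_)
open import Relation.Nullary using (¬_)

-- Ground set E = Fin n; subsets of E are Subset n.
-- A family of subsets of E is given by its (decidable) characteristic function.
Fam : ℕ → Set
Fam n = Subset n → Bool

private variable n : ℕ

_∈F_ : Subset n → Fam n → Set
I ∈F 𝓑 = 𝓑 I ≡ true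

_⊓_ : Fam n → Fam n → Fam n
(𝓐 ⊓ 𝓒) I = 𝓐 I ∧ 𝓒 I

_⊑_ : Fam n → Fam n → Set
𝓐 ⊑ 𝓒 = ∀ I → I ∈F 𝓐 → I ∈F 𝓒

_≐_ : Fam n → Fam n → Set
𝓐 ≐ 𝓒 = ∀ I → 𝓐 I ≡ 𝓒 I

NonEmpty : Fam n → Set
NonEmpty 𝓐 = ∃[ I ] I ∈F 𝓐

⟨_,_⟩≤ ⟨_,_⟩≥ ⟨_,_⟩< ⟨_,_⟩> ⟨_,_⟩= : Subset n → ℕ → Fam n
⟨ A , a ⟩≤ I = ∣ I ∩ A ∣ ≤ᵇ a
⟨ A , a ⟩≥ I = a ≤ᵇ ∣ I ∩ A ∣
⟨ A , a ⟩< I = ∣ I ∩ A ∣ <ᵇ a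
⟨ A , a ⟩> I = a <ᵇ ∣ I ∩ A ∣
⟨ A , a ⟩= I = ∣ I ∩ A ∣ ≡ᵇ a

IsBaseFamily : Fam n → Set
IsBaseFamily {n} 𝓑 =
  NonEmpty 𝓑 ×
  (∀ B₁ B₂ → B₁ ∈F 𝓑 → B₂ ∈F 𝓑 → ∀ x → x ∈ B₁ → x ∉ B₂ →
     ∃[ y ] (y ∈ B₂ × y ∉ B₁ × ((B₁ - x) ∪ ⁅ y ⁆) ∈F 𝓑))

IsRank : Fam n → Subset n → ℕ → Set
IsRank 𝓑 A k = (∃[ B ] (B ∈F 𝓑 × ∣ A ∩ B ∣ ≡ k)) × (∀ B → B ∈F 𝓑 → ∣ A ∩ B ∣ ≤ k)

Independent : Fam n → Subset n → Set
Independent 𝓑 I = ∃[ B ] (B ∈F 𝓑 × (∀ x → x ∈ I → x ∈ B))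

-- simple: no loops and no parallel pairs, i.e. every set of size ≤ 2 is independent
Simple : Fam n → Set
Simple 𝓑 = ∀ x y → Independent 𝓑 (⁅ x ⁆ ∪ ⁅ y ⁆)

-- connected: there is no separator, i.e. no A with ∅ ≠ A ≠ E and r(A) + r(E∖A) = r(E)
Connected : Fam n → Set
Connected {n} 𝓑 = ∀ A a b c → (∃[ x ] x ∈ A) → (∃[ x ] x ∉ A) →
  IsRank 𝓑 A a → IsRank 𝓑 (∁ A) b → IsRank 𝓑 ⊤ c → a + b ≢ c

cut : Fam n → List (Subset n × ℕ) → Fam n
cut 𝓑 [] = 𝓑
cut 𝓑 ((A , k) ∷ As) = cut 𝓑 As ⊓ ⟨ A , k ⟩=

AllRanks : Fam n → List (Subset n × ℕ) → Set
AllRanks 𝓑 [] = Data.Unit.⊤ where import Data.Unit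
AllRanks 𝓑 ((A , k) ∷ As) = IsRank 𝓑 A k × AllRanks 𝓑 As

IsFace : Fam n → Fam n → Set
IsFace 𝓑 𝓖 = ∃[ As ] (AllRanks 𝓑 As × 𝓖 ≐ cut 𝓑 As)

IsProperFace : Fam n → Fam n → Set
IsProperFace 𝓑 𝓖 = IsFace 𝓑 𝓖 × ¬ (𝓖 ≐ 𝓑)

IsFacet : Fam n → Fam n → Set
IsFacet 𝓑 𝓖 = IsProperFace 𝓑 𝓖 ×
  (∀ 𝓗 → IsProperFace 𝓑 𝓗 → 𝓖 ⊑ 𝓗 → 𝓗 ≐ 𝓖)

InF2 : Fam n → Subset n → Set
InF2 𝓑 F = IsRank 𝓑 F 2 × IsFacet 𝓑 (𝓑 ⊓ ⟨ F , 2 ⟩=)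

TwoDecomposable : Fam n → Subset n → ℕ → Set
TwoDecomposable 𝓑 A a =
  IsBaseFamily (𝓑 ⊓ ⟨ A , a ⟩≥) × IsBaseFamily (𝓑 ⊓ ⟨ A , a ⟩≤) ×
  NonEmpty (𝓑 ⊓ ⟨ A , a ⟩>) × NonEmpty (𝓑 ⊓ ⟨ A , a ⟩<)

-- If L has a point off B₀, then
--   L ∈ 𝓕²(M) (LineFacet): connectivity makes 𝓑 ∩ (L,2)_= proper, and simplicity (pivot)
--   makes every valid A a union of blocks of {L, E ∖ L}, which gives rigidity;
-- * consequently x and y are twins: such a line contains x iff it contains y.  An exchange
--   in 𝓑 leaving one side of the hyperplane is then repaired through the twin (trade,
--   avoid), so both sides satisfy the exchange axiom (PairDecomposition), and the theorem
--   follows with a basis through x and y and a basis avoiding both.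

module Submission where

open import Defs
open import Data.Nat using (ℕ; zero; suc; _+_; _≤_; z≤n; s≤s; s≤s⁻¹; _≤ᵇ_; _<ᵇ_; _≡ᵇ_)
open import Data.Nat.Properties
  using (+-comm; +-assoc; +-commutativeSemigroup; +-identityʳ; +-cancelˡ-≡; +-cancelʳ-≡; suc-injective;
         ≤-antisym; ≤-reflexive; <⇒≱; m≤n⇒m<n∨m≡n; m≤n+m; ≤⇒≤ᵇ; ≡ᵇ⇒≡; ≡⇒≡ᵇ; module ≤-Reasoning)
open import Algebra.Properties.CommutativeSemigroup +-commutativeSemigroup using (interchange)
open import Data.Bool using (Bool; true; false; _∧_; _∨_; not)
open import Data.Bool.Properties using (∧-conicalˡ; ∧-conicalʳ; T-≡; ¬-not) renaming (_≟_ to _≟ᵇ_)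
open import Data.Unit using (tt)
open import Data.Fin using (Fin; zero; suc; _≟_)
open import Data.Fin.Subset
open import Data.Fin.Subset.Properties
open import Data.Vec using (_∷_; []; lookup; here; there; tabulate)
open import Data.Vec.Properties using ([]=⇒lookup; lookup⇒[]=; lookup∘tabulate)
open import Data.List using ([]; _∷_)
open import Data.Product using (_×_; ∃-syntax; _,_; proj₁; proj₂)
open import Data.Sum using (_⊎_; inj₁; inj₂)
open import Data.Empty using (⊥-elim)
open import Function using (_∘′_)
open import Function.Bundles using (Equivalence)
open import Relation.Binary.PropositionalEquality
  using (_≡_; _≢_; ≢-sym; refl; sym; trans; cong; cong₂; subst; module ≡-Reasoning)
open import Relation.Nullary using (¬_; Dec; yes; no; contradiction)

private variable
  n : ℕ

resolve : ∀ {a b} {A : Set a} {B : Set b} → ¬ A → A ⊎ B → B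
resolve ¬a (inj₁ a) = contradiction a ¬a
resolve ¬a (inj₂ b) = b

resolve′ : ∀ {a b} {A : Set a} {B : Set b} → ¬ B → A ⊎ B → A
resolve′ ¬b (inj₁ a) = a
resolve′ ¬b (inj₂ b) = contradiction b ¬b

bit : Bool → ℕ
bit true  = 1
bit false = 0

ind : Fin n → Subset n → ℕ
ind x A = bit (lookup A x)

∣∷∣ : ∀ b (p : Subset n) → ∣ b ∷ p ∣ ≡ bit b + ∣ p ∣
∣∷∣ true  p = refl
∣∷∣ false p = refl

∈⇒ind≡1 : ∀ {x : Fin n} {A} → x ∈ A → ind x A ≡ 1
∈⇒ind≡1 x∈A rewrite []=⇒lookup x∈A = refl

∉⇒ind≡0 : ∀ {x : Fin n} {A} → x ∉ A → ind x A ≡ 0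
∉⇒ind≡0 {x = x} {A} x∉A with lookup A x in eq
... | true  = contradiction (lookup⇒[]= x A eq) x∉A
... | false = refl

ind≡1⇒∈ : ∀ {x : Fin n} {A} → ind x A ≡ 1 → x ∈ A
ind≡1⇒∈ {x = x} {A} ind≡1 with lookup A x in eq
... | true  = lookup⇒[]= x A eq
... | false = contradiction ind≡1 λ ()

same-ind-∈ : ∀ {A : Subset n} {i j} → ind i A ≡ ind j A → j ∈ A → i ∈ A
same-ind-∈ same j∈A = ind≡1⇒∈ (trans same (∈⇒ind≡1 j∈A))

same-ind-∉ : ∀ {A : Subset n} {i j} → ind i A ≡ ind j A → j ∉ A → i ∉ A
same-ind-∉ same j∉A i∈A = j∉A (same-ind-∈ (sym same) i∈A)

∈-─⇒∉ : ∀ (p q : Subset n) {x} → x ∈ p ─ q → x ∉ q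
∈-─⇒∉ (_ ∷ p) (false ∷ q) (there x∈) (there x∈q) = ∈-─⇒∉ p q x∈ x∈q
∈-─⇒∉ (_ ∷ p) (true  ∷ q) (there x∈) (there x∈q) = ∈-─⇒∉ p q x∈ x∈q

∈-remove⁻ : ∀ {X : Subset n} {x y} → x ∈ X - y → x ∈ X × x ≢ y
∈-remove⁻ {X = X} {y = y} x∈ =
  p─q⊆p X ⁅ y ⁆ x∈ , λ { refl → ∈-─⇒∉ X ⁅ y ⁆ x∈ (x∈⁅x⁆ y) }

∉-remove : ∀ {X : Subset n} {x} → x ∉ X - x
∉-remove x∈ = proj₂ (∈-remove⁻ x∈) refl

∈-insert⁻ : ∀ {X : Subset n} {x y} → x ∈ X ∪ ⁅ y ⁆ → x ∈ X ⊎ x ≡ y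
∈-insert⁻ {X = X} {y = y} x∈ with x∈p∪q⁻ X ⁅ y ⁆ x∈
... | inj₁ x∈X = inj₁ x∈X
... | inj₂ x∈y = inj₂ (x∈⁅y⁆⇒x≡y y x∈y)

∈-insertˡ : ∀ {X : Subset n} {x y} → x ∈ X → x ∈ X ∪ ⁅ y ⁆
∈-insertˡ x∈X = x∈p∪q⁺ (inj₁ x∈X)

∈-insertʳ : ∀ {X : Subset n} {y} → y ∈ X ∪ ⁅ y ⁆
∈-insertʳ {y = y} = x∈p∪q⁺ (inj₂ (x∈⁅x⁆ y))

∈-pairˡ : ∀ {x y : Fin n} → x ∈ ⁅ x ⁆ ∪ ⁅ y ⁆
∈-pairˡ {x = x} = x∈p∪q⁺ (inj₁ (x∈⁅x⁆ x))

∈-pairʳ : ∀ {x y : Fin n} → y ∈ ⁅ x ⁆ ∪ ⁅ y ⁆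
∈-pairʳ {y = y} = x∈p∪q⁺ (inj₂ (x∈⁅x⁆ y))

infix 25 _[_↦_]
_[_↦_] : Subset n → Fin n → Fin n → Subset n
X [ x ↦ y ] = (X - x) ∪ ⁅ y ⁆

∈-swap⁻ : ∀ {X : Subset n} {x y i} → i ∈ X [ x ↦ y ] → (i ∈ X × i ≢ x) ⊎ i ≡ y
∈-swap⁻ i∈ with ∈-insert⁻ i∈
... | inj₁ i∈X-x = inj₁ (∈-remove⁻ i∈X-x)
... | inj₂ i≡y   = inj₂ i≡y

∈-swap⁺ : ∀ {X : Subset n} {x y i} → i ∈ X → i ≢ x → i ∈ X [ x ↦ y ]
∈-swap⁺ i∈X i≢x = ∈-insertˡ (x∈p∧x≢y⇒x∈p-y i∈X i≢x)

∉-swap : ∀ {X : Subset n} {x y i} → i ∉ X → i ≢ y → i ∉ X [ x ↦ y ]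
∉-swap i∉X i≢y i∈ with ∈-swap⁻ i∈
... | inj₁ (i∈X , _) = i∉X i∈X
... | inj₂ i≡y       = i≢y i≡y

∉-swap⁻ : ∀ {X : Subset n} {x y i} → i ∉ X [ x ↦ y ] → i ≢ x → i ∉ X
∉-swap⁻ i∉X′ i≢x i∈X = i∉X′ (∈-swap⁺ i∈X i≢x)

left-out : ∀ {X : Subset n} {x y i} → i ∈ X → i ∉ X [ x ↦ y ] → i ≡ x
left-out {x = x} {i = i} i∈X i∉X′ with i ≟ x
... | yes i≡x = i≡x
... | no  i≢x = contradiction (∈-swap⁺ i∈X i≢x) i∉X′

swap-self : ∀ {X : Subset n} {x} → x ∈ X → X [ x ↦ x ] ≡ X
swap-self {X = X} {x} x∈X = ⊆-antisym ⊆X X⊆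
  where
  ⊆X : X [ x ↦ x ] ⊆ X
  ⊆X i∈ with ∈-swap⁻ i∈
  ... | inj₁ (i∈X , _) = i∈X
  ... | inj₂ refl      = x∈X
  X⊆ : X ⊆ X [ x ↦ x ]
  X⊆ {i} i∈X with i ≟ x
  ... | yes refl = ∈-insertʳ
  ... | no i≢x   = ∈-swap⁺ i∈X i≢x

insert-present : ∀ {X : Subset n} {x} → x ∈ X → X ∪ ⁅ x ⁆ ≡ X
insert-present {X = X} {x} x∈X = ⊆-antisym ⊆X ∈-insertˡ
  where
  ⊆X : X ∪ ⁅ x ⁆ ⊆ X
  ⊆X i∈ with ∈-insert⁻ i∈
  ... | inj₁ i∈X = i∈X
  ... | inj₂ refl = x∈X

count-insert : ∀ (X A : Subset n) y → y ∉ X → ∣ (X ∪ ⁅ y ⁆) ∩ A ∣ ≡ ∣ X ∩ A ∣ + ind y A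
count-insert (false ∷ X) (a ∷ A) zero y∉X = begin
  ∣ a ∷ (X ∪ ⊥) ∩ A ∣     ≡⟨ ∣∷∣ a ((X ∪ ⊥) ∩ A) ⟩
  bit a + ∣ (X ∪ ⊥) ∩ A ∣  ≡⟨ cong (λ Z → bit a + ∣ Z ∩ A ∣) (∪-identityʳ X) ⟩
  bit a + ∣ X ∩ A ∣        ≡⟨ +-comm (bit a) _ ⟩
  ∣ X ∩ A ∣ + bit a        ∎
  where open ≡-Reasoning
count-insert (true ∷ X) (a ∷ A) zero y∉X = contradiction here y∉X
count-insert (b ∷ X) (a ∷ A) (suc y) y∉X = begin
  ∣ ((b ∨ false) ∧ a) ∷ ((X ∪ ⁅ y ⁆) ∩ A) ∣      ≡⟨ ∣∷∣ ((b ∨ false) ∧ a) ((X ∪ ⁅ y ⁆) ∩ A) ⟩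
  bit ((b ∨ false) ∧ a) + ∣ (X ∪ ⁅ y ⁆) ∩ A ∣   ≡⟨ cong₂ (λ c m → bit (c ∧ a) + m) (∨-false b)
                                                       (count-insert X A y (y∉X ∘′ there)) ⟩
  bit (b ∧ a) + (∣ X ∩ A ∣ + ind y A)            ≡⟨ +-assoc (bit (b ∧ a)) _ _ ⟨
  bit (b ∧ a) + ∣ X ∩ A ∣ + ind y A              ≡⟨ cong (_+ ind y A) (∣∷∣ (b ∧ a) (X ∩ A)) ⟨
  ∣ (b ∷ X) ∩ (a ∷ A) ∣ + ind y A                ∎
  where
  open ≡-Reasoning
  ∨-false : ∀ c → c ∨ false ≡ c
  ∨-false true  = refl
  ∨-false false = refl

count-remove : ∀ (X A : Subset n) {x} → x ∈ X → ∣ X ∩ A ∣ ≡ ∣ (X - x) ∩ A ∣ + ind x A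
count-remove X A {x} x∈X = begin
  ∣ X ∩ A ∣                 ≡⟨ cong (λ Z → ∣ Z ∩ A ∣) (swap-self x∈X) ⟨
  ∣ X [ x ↦ x ] ∩ A ∣       ≡⟨ count-insert (X - x) A x ∉-remove ⟩
  ∣ (X - x) ∩ A ∣ + ind x A ∎
  where open ≡-Reasoning

count-swap : ∀ (X A : Subset n) {x y} → x ∈ X → y ∉ X →
  ∣ X [ x ↦ y ] ∩ A ∣ + ind x A ≡ ∣ X ∩ A ∣ + ind y A
count-swap X A {x} {y} x∈X y∉X = begin
  ∣ X [ x ↦ y ] ∩ A ∣ + ind x A             ≡⟨ cong (_+ ind x A) (count-insert (X - x) A y y∉X-x) ⟩
  ∣ (X - x) ∩ A ∣ + ind y A + ind x A       ≡⟨ +-assoc _ (ind y A) (ind x A) ⟩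
  ∣ (X - x) ∩ A ∣ + (ind y A + ind x A)     ≡⟨ cong (∣ (X - x) ∩ A ∣ +_) (+-comm (ind y A) (ind x A)) ⟩
  ∣ (X - x) ∩ A ∣ + (ind x A + ind y A)     ≡⟨ +-assoc _ (ind x A) (ind y A) ⟨
  ∣ (X - x) ∩ A ∣ + ind x A + ind y A       ≡⟨ cong (_+ ind y A) (count-remove X A x∈X) ⟨
  ∣ X ∩ A ∣ + ind y A                       ∎
  where
  open ≡-Reasoning
  y∉X-x : y ∉ X - x
  y∉X-x y∈ = y∉X (proj₁ (∈-remove⁻ y∈))

swap-keeps-count : ∀ (X A : Subset n) {x y} → x ∈ X → y ∉ X →
  ind x A ≡ ind y A → ∣ X [ x ↦ y ] ∩ A ∣ ≡ ∣ X ∩ A ∣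
swap-keeps-count X A {x} {y} x∈X y∉X same =
  +-cancelʳ-≡ (ind x A) _ _ (trans (count-swap X A x∈X y∉X) (cong (∣ X ∩ A ∣ +_) (sym same)))

count-kept⇒same : ∀ (X A : Subset n) {x y} → x ∈ X → y ∉ X →
  ∣ X [ x ↦ y ] ∩ A ∣ ≡ ∣ X ∩ A ∣ → ind x A ≡ ind y A
count-kept⇒same X A {x} {y} x∈X y∉X kept =
  +-cancelˡ-≡ ∣ X ∩ A ∣ _ _ (trans (cong (_+ ind x A) (sym kept)) (count-swap X A x∈X y∉X))

count-split : ∀ (X A : Subset n) → ∣ X ∩ A ∣ + ∣ X ∩ ∁ A ∣ ≡ ∣ X ∣
count-split [] [] = refl
count-split (b ∷ X) (a ∷ A) = begin
  ∣ (b ∧ a) ∷ X ∩ A ∣ + ∣ (b ∧ not a) ∷ X ∩ ∁ A ∣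
    ≡⟨ cong₂ _+_ (∣∷∣ (b ∧ a) (X ∩ A)) (∣∷∣ (b ∧ not a) (X ∩ ∁ A)) ⟩
  (bit (b ∧ a) + ∣ X ∩ A ∣) + (bit (b ∧ not a) + ∣ X ∩ ∁ A ∣)
    ≡⟨ interchange (bit (b ∧ a)) (∣ X ∩ A ∣) (bit (b ∧ not a)) (∣ X ∩ ∁ A ∣) ⟩
  (bit (b ∧ a) + bit (b ∧ not a)) + (∣ X ∩ A ∣ + ∣ X ∩ ∁ A ∣)
    ≡⟨ cong₂ _+_ (split-bit b a) (count-split X A) ⟩
  bit b + ∣ X ∣
    ≡⟨ ∣∷∣ b X ⟨
  ∣ b ∷ X ∣ ∎
  where
  open ≡-Reasoning
  split-bit : ∀ b a → bit (b ∧ a) + bit (b ∧ not a) ≡ bit b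
  split-bit true  true  = refl
  split-bit true  false = refl
  split-bit false a     = refl

count-⊤ : ∀ (X : Subset n) → ∣ X ∩ ⊤ ∣ ≡ ∣ X ∣
count-⊤ X = cong ∣_∣ (∩-identityʳ X)

count-⊥ : ∀ (X : Subset n) → ∣ X ∩ ⊥ ∣ ≡ 0
count-⊥ {n} X = trans (cong ∣_∣ (∩-zeroʳ X)) (∣⊥∣≡0 n)

count-singleton : ∀ (A : Subset n) x → ∣ ⁅ x ⁆ ∩ A ∣ ≡ ind x A
count-singleton A x = begin
  ∣ ⁅ x ⁆ ∩ A ∣         ≡⟨ cong (λ Z → ∣ Z ∩ A ∣) (∪-identityˡ ⁅ x ⁆) ⟨
  ∣ (⊥ ∪ ⁅ x ⁆) ∩ A ∣   ≡⟨ count-insert ⊥ A x ∉⊥ ⟩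
  ∣ ⊥ ∩ A ∣ + ind x A   ≡⟨ cong (λ Z → ∣ Z ∣ + ind x A) (∩-comm ⊥ A) ⟩
  ∣ A ∩ ⊥ ∣ + ind x A   ≡⟨ cong (_+ ind x A) (count-⊥ A) ⟩
  ind x A               ∎
  where open ≡-Reasoning

count-⊆ : ∀ {X A : Subset n} → X ⊆ A → ∣ X ∩ A ∣ ≡ ∣ X ∣
count-⊆ {X = X} {A} X⊆A = cong ∣_∣ (⊆-antisym (p∩q⊆p X A) (λ i∈X → x∈p∩q⁺ (i∈X , X⊆A i∈X)))

ind-⊤ : ∀ (x : Fin n) → ind x ⊤ ≡ 1
ind-⊤ x = ∈⇒ind≡1 {A = ⊤} (∈⊤ {x = x})

size-remove : ∀ {X : Subset n} {x} → x ∈ X → ∣ X ∣ ≡ suc ∣ X - x ∣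
size-remove {X = X} {x} x∈X = begin
  ∣ X ∣                     ≡⟨ count-⊤ X ⟨
  ∣ X ∩ ⊤ ∣                 ≡⟨ count-remove X ⊤ x∈X ⟩
  ∣ (X - x) ∩ ⊤ ∣ + ind x ⊤  ≡⟨ cong₂ _+_ (count-⊤ (X - x)) (ind-⊤ x) ⟩
  ∣ X - x ∣ + 1             ≡⟨ +-comm (∣ X - x ∣) 1 ⟩
  suc ∣ X - x ∣             ∎
  where open ≡-Reasoning

size-swap : ∀ {X : Subset n} {x y} → x ∈ X → y ∉ X → ∣ X [ x ↦ y ] ∣ ≡ ∣ X ∣
size-swap {X = X} {x} {y} x∈X y∉X = begin
  ∣ X [ x ↦ y ] ∣       ≡⟨ count-⊤ (X [ x ↦ y ]) ⟨
  ∣ X [ x ↦ y ] ∩ ⊤ ∣   ≡⟨ swap-keeps-count X ⊤ x∈X y∉X (trans (ind-⊤ x) (sym (ind-⊤ y))) ⟩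
  ∣ X ∩ ⊤ ∣             ≡⟨ count-⊤ X ⟩
  ∣ X ∣                 ∎
  where open ≡-Reasoning

⊆-by-size : ∀ {X Y : Subset n} → X ⊆ Y → ∣ Y ∣ ≤ ∣ X ∣ → Y ⊆ X
⊆-by-size {X = X} {Y} X⊆Y ∣Y∣≤∣X∣ {i} i∈Y with i ∈? X
... | yes i∈X = i∈X
... | no  i∉X = contradiction ∣Y∣≤∣X∣ (<⇒≱ (p⊂q⇒∣p∣<∣q∣ (X⊆Y , i , i∈Y , i∉X)))

full-count⇒⊆ : ∀ {X A : Subset n} → ∣ X ∣ ≤ ∣ X ∩ A ∣ → X ⊆ A
full-count⇒⊆ {X = X} {A} ∣X∣≤ i∈X = proj₂ (x∈p∩q⁻ X A (⊆-by-size (p∩q⊆p X A) ∣X∣≤ i∈X))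

nonempty-by-size : ∀ (X : Subset n) {k} → ∣ X ∣ ≡ suc k → Nonempty X
nonempty-by-size {n} X ∣X∣≡1+k with nonempty? X
... | yes ne = ne
... | no  empty with trans (sym (∣⊥∣≡0 n)) (trans (cong ∣_∣ (sym (Empty-unique empty))) ∣X∣≡1+k)
... | ()

third : ∀ {X : Subset n} → ∣ X ∣ ≡ 3 → ∀ {u v} → u ∈ X → v ∈ X → u ≢ v →
  ∃[ w ] (w ∈ X × w ≢ u × w ≢ v)
third {X = X} ∣X∣≡3 {u} {v} u∈X v∈X u≢v with nonempty-by-size (X - u - v) ∣X-u-v∣≡1
  where
  v∈X-u : v ∈ X - u
  v∈X-u = x∈p∧x≢y⇒x∈p-y v∈X (λ v≡u → u≢v (sym v≡u))
  ∣X-u-v∣≡1 : ∣ X - u - v ∣ ≡ 1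
  ∣X-u-v∣≡1 = suc-injective (suc-injective
    (trans (sym (trans (size-remove u∈X) (cong suc (size-remove v∈X-u)))) ∣X∣≡3))
... | w , w∈X-u-v with ∈-remove⁻ w∈X-u-v
... | w∈X-u , w≢v = w , proj₁ (∈-remove⁻ w∈X-u) , proj₂ (∈-remove⁻ w∈X-u) , w≢v

only-three : ∀ {X : Subset n} → ∣ X ∣ ≡ 3 → ∀ {u v w} → u ∈ X → v ∈ X → w ∈ X →
  u ≢ v → u ≢ w → v ≢ w → ∀ {i} → i ∈ X → i ≡ u ⊎ i ≡ v ⊎ i ≡ w
only-three {X = X} ∣X∣≡3 {u} {v} {w} u∈X v∈X w∈X u≢v u≢w v≢w {i} i∈X
  with i ≟ u | i ≟ v | i ≟ w
... | yes i≡u | _       | _       = inj₁ i≡u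
... | no  _   | yes i≡v | _       = inj₂ (inj₁ i≡v)
... | no  _   | no  _   | yes i≡w = inj₂ (inj₂ i≡w)
... | no  i≢u | no  i≢v | no  i≢w with trans (sym ∣X∣≡3) four-removals
  where
  remove : ∀ {Y : Subset n} {a b} → a ∈ Y → a ≢ b → a ∈ Y - b
  remove = x∈p∧x≢y⇒x∈p-y
  four-removals : ∣ X ∣ ≡ suc (suc (suc (suc ∣ X - u - v - w - i ∣)))
  four-removals =
    trans (size-remove u∈X) (cong suc
    (trans (size-remove (remove v∈X (λ v≡u → u≢v (sym v≡u)))) (cong suc
    (trans (size-remove (remove (remove w∈X (λ w≡u → u≢w (sym w≡u))) (λ w≡v → v≢w (sym w≡v))))
    (cong suc (size-remove (remove (remove (remove i∈X i≢u) i≢v) i≢w)))))))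
... | ()

∧-elimˡ : ∀ {a b} → a ∧ b ≡ true → a ≡ true
∧-elimˡ {a} {b} = ∧-conicalˡ a b

∧-elimʳ : ∀ {a b} → a ∧ b ≡ true → b ≡ true
∧-elimʳ {a} {b} = ∧-conicalʳ a b

∧-intro : ∀ {a b} → a ≡ true → b ≡ true → a ∧ b ≡ true
∧-intro refl b≡true = b≡true

level⇒count : ∀ {m a} → (m ≡ᵇ a) ≡ true → m ≡ a
level⇒count {m} {a} m≡ᵇa = ≡ᵇ⇒≡ m a (Equivalence.from T-≡ m≡ᵇa)

count⇒level : ∀ {m a} → m ≡ a → (m ≡ᵇ a) ≡ true
count⇒level {m} {a} m≡a = Equivalence.to T-≡ (≡⇒≡ᵇ m a m≡a)

⊓-absorb : ∀ (𝓐 𝓒 : Fam n) → 𝓐 ⊑ 𝓒 → (𝓐 ⊓ 𝓒) ≐ 𝓐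
⊓-absorb 𝓐 𝓒 𝓐⊑𝓒 I with 𝓐 I in I∈?
... | true  = 𝓐⊑𝓒 I I∈?
... | false = refl

⊑-antisym : ∀ (𝓐 𝓒 : Fam n) → 𝓐 ⊑ 𝓒 → 𝓒 ⊑ 𝓐 → 𝓐 ≐ 𝓒
⊑-antisym 𝓐 𝓒 𝓐⊑𝓒 𝓒⊑𝓐 I with 𝓐 I in I∈𝓐 | 𝓒 I in I∈𝓒
... | true  | _     = trans (sym (𝓐⊑𝓒 I I∈𝓐)) I∈𝓒
... | false | false = refl
... | false | true  = trans (sym I∈𝓐) (𝓒⊑𝓐 I I∈𝓒)

Rigid : Fam n → Subset n → ℕ → Set
Rigid 𝓑 L k = ∀ A a → (∀ B → B ∈F 𝓑 → ∣ B ∩ L ∣ ≡ k → ∣ B ∩ A ∣ ≡ a) →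
  (∀ B → B ∈F 𝓑 → ∣ B ∩ A ∣ ≡ a) ⊎ (∀ B → B ∈F 𝓑 → ∣ B ∩ A ∣ ≡ a → ∣ B ∩ L ∣ ≡ k)

-- A proper, rigid level set 𝓑 ∩ (L,r(L))_= is a facet: a face containing it is cut out by
-- equations valid on it, and rigidity makes each of them either redundant or confining.
facet-criterion : ∀ (𝓑 : Fam n) L k → IsRank 𝓑 L k → ¬ (∀ B → B ∈F 𝓑 → ∣ B ∩ L ∣ ≡ k) →
  Rigid 𝓑 L k → IsFacet 𝓑 (𝓑 ⊓ ⟨ L , k ⟩=)
facet-criterion 𝓑 L k rank-L not-all rigid = (face , proper) , maximal
  where
  𝓕 : Fam _
  𝓕 = 𝓑 ⊓ ⟨ L , k ⟩=

  face : IsFace 𝓑 𝓕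
  face = (L , k) ∷ [] , (rank-L , tt) , λ _ → refl

  proper : ¬ (𝓕 ≐ 𝓑)
  proper 𝓕≐𝓑 = not-all λ B B∈𝓑 → level⇒count (∧-elimʳ (trans (𝓕≐𝓑 B) B∈𝓑))

  cut-dichotomy : ∀ As → 𝓕 ⊑ cut 𝓑 As → cut 𝓑 As ≐ 𝓑 ⊎ cut 𝓑 As ⊑ 𝓕
  cut-dichotomy [] _ = inj₁ (λ _ → refl)
  cut-dichotomy ((A , a) ∷ As) 𝓕⊑ with cut-dichotomy As (λ I I∈ → ∧-elimˡ (𝓕⊑ I I∈))
  ... | inj₂ within = inj₂ (λ I I∈ → within I (∧-elimˡ I∈))
  ... | inj₁ whole with rigid A a (λ B B∈𝓑 on-L → level⇒count (∧-elimʳ (𝓕⊑ B (∧-intro B∈𝓑 (count⇒level on-L)))))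
  ...   | inj₁ valid = inj₁ λ I →
            trans (cong (_∧ ⟨ A , a ⟩= I) (whole I)) (⊓-absorb 𝓑 ⟨ A , a ⟩= (λ B B∈𝓑 → count⇒level (valid B B∈𝓑)) I)
  ...   | inj₂ confining = inj₂ inside-𝓕
    where
    inside-𝓕 : cut 𝓑 ((A , a) ∷ As) ⊑ 𝓕
    inside-𝓕 I I∈ = ∧-intro I∈𝓑 (count⇒level (confining I I∈𝓑 (level⇒count (∧-elimʳ I∈))))
      where
      I∈𝓑 : I ∈F 𝓑
      I∈𝓑 = trans (sym (whole I)) (∧-elimˡ I∈)

  maximal : ∀ 𝓗 → IsProperFace 𝓑 𝓗 → 𝓕 ⊑ 𝓗 → 𝓗 ≐ 𝓕
  maximal 𝓗 ((As , _ , 𝓗≐cut) , 𝓗≭𝓑) 𝓕⊑𝓗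
    with cut-dichotomy As (λ I I∈ → trans (sym (𝓗≐cut I)) (𝓕⊑𝓗 I I∈))
  ... | inj₁ whole  = ⊥-elim (𝓗≭𝓑 (λ I → trans (𝓗≐cut I) (whole I)))
  ... | inj₂ within = ⊑-antisym 𝓗 𝓕 (λ I I∈ → within I (trans (sym (𝓗≐cut I)) I∈)) 𝓕⊑𝓗

Exchange : Fam n → Set
Exchange 𝓑 = ∀ B₁ B₂ → B₁ ∈F 𝓑 → B₂ ∈F 𝓑 → ∀ x → x ∈ B₁ → x ∉ B₂ →
  ∃[ y ] (y ∈ B₂ × y ∉ B₁ × B₁ [ x ↦ y ] ∈F 𝓑)

basis? : ∀ (𝓑 : Fam n) I → Dec (I ∈F 𝓑)
basis? 𝓑 I = 𝓑 I ≟ᵇ true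

-- All bases have the same size: move the elements of B′ ∖ B into B one exchange at a time.
bases-equicardinal : ∀ {𝓑 : Fam n} → Exchange 𝓑 → ∀ {B′ B} → B′ ∈F 𝓑 → B ∈F 𝓑 → ∣ B′ ∣ ≤ ∣ B ∣
bases-equicardinal {𝓑 = 𝓑} exch B′∈ B∈ = by-difference _ B′∈ B∈ refl
  where
  by-difference : ∀ k {B′ B} → B′ ∈F 𝓑 → B ∈F 𝓑 → ∣ B′ ∩ ∁ B ∣ ≡ k → ∣ B′ ∣ ≤ ∣ B ∣
  by-difference zero {B′} {B} _ _ none = begin
    ∣ B′ ∣                          ≡⟨ count-split B′ B ⟨
    ∣ B′ ∩ B ∣ + ∣ B′ ∩ ∁ B ∣       ≡⟨ cong (∣ B′ ∩ B ∣ +_) none ⟩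
    ∣ B′ ∩ B ∣ + 0                  ≡⟨ +-identityʳ _ ⟩
    ∣ B′ ∩ B ∣                      ≤⟨ ∣p∩q∣≤∣q∣ B′ B ⟩
    ∣ B ∣                           ∎
    where open ≤-Reasoning
  by-difference (suc k) {B′} {B} B′∈ B∈ ∣B′∖B∣≡1+k with nonempty-by-size (B′ ∩ ∁ B) ∣B′∖B∣≡1+k
  ... | x , x∈B′∖B with x∈p∩q⁻ B′ (∁ B) x∈B′∖B
  ... | x∈B′ , x∈∁B with exch B′ B B′∈ B∈ x x∈B′ (x∈∁p⇒x∉p x∈∁B)
  ... | y , y∈B , y∉B′ , B″∈ =
    subst (_≤ ∣ B ∣) (size-swap x∈B′ y∉B′) (by-difference k B″∈ B∈ (+-cancelʳ-≡ 1 _ _ (begin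
      ∣ B′ [ x ↦ y ] ∩ ∁ B ∣ + 1             ≡⟨ cong (∣ B′ [ x ↦ y ] ∩ ∁ B ∣ +_) (∈⇒ind≡1 x∈∁B) ⟨
      ∣ B′ [ x ↦ y ] ∩ ∁ B ∣ + ind x (∁ B)   ≡⟨ count-swap B′ (∁ B) x∈B′ y∉B′ ⟩
      ∣ B′ ∩ ∁ B ∣ + ind y (∁ B)             ≡⟨ cong₂ _+_ ∣B′∖B∣≡1+k (∉⇒ind≡0 (x∈p⇒x∉∁p y∈B)) ⟩
      suc k + 0                              ≡⟨ +-comm (suc k) 0 ⟩
      suc k                                  ≡⟨ +-comm k 1 ⟨
      k + 1                                  ∎)))
    where open ≡-Reasoning

basis-size : ∀ {𝓑 : Fam n} → Exchange 𝓑 → IsRank 𝓑 ⊤ 3 → ∀ B → B ∈F 𝓑 → ∣ B ∣ ≡ 3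
basis-size exch ((B₀ , B₀∈ , ∣B₀∣≡3) , at-most-3) B B∈ = ≤-antisym
  (subst (_≤ 3) (cong ∣_∣ (∩-identityˡ B)) (at-most-3 B B∈))
  (subst (_≤ ∣ B ∣) (trans (cong ∣_∣ (sym (∩-identityˡ B₀))) ∣B₀∣≡3) (bases-equicardinal exch B₀∈ B∈))

augment : ∀ {𝓑 : Fam n} → Exchange 𝓑 → ∀ {D B f} → D ∈F 𝓑 → B ∈F 𝓑 → f ∈ D →
  ∃[ c ] (c ∈ B × D [ f ↦ c ] ∈F 𝓑)
augment {𝓑 = 𝓑} exch {D} {B} {f} D∈ B∈ f∈D with f ∈? B
... | yes f∈B = f , f∈B , subst (_∈F 𝓑) (sym (swap-self f∈D)) D∈
... | no  f∉B with exch D B D∈ B∈ f f∈D f∉B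
... | c , c∈B , _ , D′∈ = c , c∈B , D′∈

⊆-basis : ∀ {𝓑 : Fam n} {B X} → B ∈F 𝓑 → X ⊆ B → ∣ B ∣ ≤ ∣ X ∣ → X ∈F 𝓑
⊆-basis {𝓑 = 𝓑} B∈ X⊆B ∣B∣≤∣X∣ = subst (_∈F 𝓑) (⊆-antisym (⊆-by-size X⊆B ∣B∣≤∣X∣) X⊆B) B∈

-- The line spanned by S: the points e for which S ∪ {e} is not a basis.  When S is a
-- two-element independent set of a rank-3 matroid this is its closure, a rank-2 flat.
line : Fam n → Subset n → Subset n
line 𝓑 S = tabulate (λ e → not (𝓑 (S ∪ ⁅ e ⁆)))

module Lines {n} (𝓑 : Fam n) where
  ∈line⁺ : ∀ {S e} → ¬ (S ∪ ⁅ e ⁆) ∈F 𝓑 → e ∈ line 𝓑 S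
  ∈line⁺ {S} {e} S+e∉𝓑 =
    lookup⇒[]= e (line 𝓑 S) (trans (lookup∘tabulate _ e) (cong not (¬-not S+e∉𝓑)))

  ∈line⁻ : ∀ {S e} → e ∈ line 𝓑 S → ¬ (S ∪ ⁅ e ⁆) ∈F 𝓑
  ∈line⁻ {S} {e} e∈L S+e∈𝓑
    with trans (cong not (sym S+e∈𝓑)) (trans (sym (lookup∘tabulate _ e)) ([]=⇒lookup e∈L))
  ... | ()

  ∉line⇒basis : ∀ {S e} → e ∉ line 𝓑 S → (S ∪ ⁅ e ⁆) ∈F 𝓑
  ∉line⇒basis {S} {e} e∉L with basis? 𝓑 (S ∪ ⁅ e ⁆)
  ... | yes S+e∈𝓑 = S+e∈𝓑
  ... | no  S+e∉𝓑 = contradiction (∈line⁺ S+e∉𝓑) e∉L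

  removed∉line : ∀ {B q} → B ∈F 𝓑 → q ∈ B → q ∉ line 𝓑 (B - q)
  removed∉line B∈ q∈B q∈L = ∈line⁻ q∈L (subst (_∈F 𝓑) (sym (swap-self q∈B)) B∈)

  ⊆line : ∀ {S} → (∀ B → B ∈F 𝓑 → ∣ B ∣ ≢ ∣ S ∣) → S ⊆ line 𝓑 S
  ⊆line no-basis-of-size s∈S =
    ∈line⁺ (λ S+s∈𝓑 → no-basis-of-size _ (subst (_∈F 𝓑) (insert-present s∈S) S+s∈𝓑) refl)

-- u and v are twins when every nontrivial line spanned by two points of a basis, i.e. the
-- line through B - q (B ∈ 𝓑, q ∈ B) containing some t ∉ B, contains v as soon as it contains u.
Twin : Fam n → Fin n → Fin n → Set
Twin 𝓑 u v = ∀ {B q t} → B ∈F 𝓑 → q ∈ B → t ∉ B → t ∈ line 𝓑 (B - q) →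
  u ∈ line 𝓑 (B - q) → v ∈ line 𝓑 (B - q)

module Rank3 {n} (𝓑 : Fam n) (exch : Exchange 𝓑) (size3 : ∀ B → B ∈F 𝓑 → ∣ B ∣ ≡ 3) where
  open Lines 𝓑

  ⊆line-removed : ∀ {B q} → B ∈F 𝓑 → q ∈ B → B - q ⊆ line 𝓑 (B - q)
  ⊆line-removed {B} {q} B∈ q∈B = ⊆line λ B′ B′∈ ∣B′∣≡∣B-q∣ → contradiction (begin
    3             ≡⟨ size3 B B∈ ⟨
    ∣ B ∣         ≡⟨ size-remove q∈B ⟩
    suc ∣ B - q ∣ ≡⟨ cong suc ∣B′∣≡∣B-q∣ ⟨
    suc ∣ B′ ∣    ≡⟨ cong suc (size3 B′ B′∈) ⟩
    4             ∎) λ ()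
    where open ≡-Reasoning

  -- Writing B₀ = {a, q, b}, take a basis
  -- D ⊇ {b, p} and trade its third point for some c ∈ B₀; c = b is too small, c = a would make
  -- {a, b, p} = B₀[q ↦ p] a basis, so c = q and {q, b, p} = B₀[a ↦ p] is a basis.
  pivot : Simple 𝓑 → ∀ {B₀ a q p} → B₀ ∈F 𝓑 → a ∈ B₀ → q ∈ B₀ → a ≢ q → p ∉ B₀ →
    ¬ B₀ [ q ↦ p ] ∈F 𝓑 → B₀ [ a ↦ p ] ∈F 𝓑
  pivot simple {B₀} {a} {q} {p} B₀∈ a∈B₀ q∈B₀ a≢q p∉B₀ q-blocked
    with third (size3 B₀ B₀∈) a∈B₀ q∈B₀ a≢q
  ... | b , b∈B₀ , b≢a , b≢q with simple b p
  ... | D , D∈ , bp⊆D = through D∈ (bp⊆D b ∈-pairˡ) (bp⊆D p ∈-pairʳ)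
    where
    B₀-points : ∀ {i} → i ∈ B₀ → i ≡ a ⊎ i ≡ q ⊎ i ≡ b
    B₀-points = only-three (size3 B₀ B₀∈) a∈B₀ q∈B₀ b∈B₀ a≢q (≢-sym b≢a) (≢-sym b≢q)

    rest-without-q : ∀ {i} → i ∈ B₀ → i ≢ q → i ≡ a ⊎ i ≡ b
    rest-without-q i∈B₀ i≢q with B₀-points i∈B₀
    ... | inj₁ i≡a        = inj₁ i≡a
    ... | inj₂ (inj₁ i≡q) = contradiction i≡q i≢q
    ... | inj₂ (inj₂ i≡b) = inj₂ i≡b

    rest-without-a : ∀ {i} → i ∈ B₀ → i ≢ a → i ≡ q ⊎ i ≡ b
    rest-without-a i∈B₀ i≢a with B₀-points i∈B₀
    ... | inj₁ i≡a        = contradiction i≡a i≢a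
    ... | inj₂ (inj₁ i≡q) = inj₁ i≡q
    ... | inj₂ (inj₂ i≡b) = inj₂ i≡b

    fits : ∀ {D f c r} → D [ f ↦ c ] ∈F 𝓑 → b ∈ D → p ∈ D → f ≢ b → f ≢ p → r ∈ B₀ →
      (∀ {i} → i ∈ B₀ → i ≢ r → i ≡ c ⊎ i ≡ b) → B₀ [ r ↦ p ] ∈F 𝓑
    fits {D} {f} {c} {r} D′∈ b∈D p∈D f≢b f≢p r∈B₀ rest = ⊆-basis {𝓑 = 𝓑} D′∈ ⊆D′
      (≤-reflexive (trans (size3 (D [ f ↦ c ]) D′∈) (sym (trans (size-swap r∈B₀ p∉B₀) (size3 B₀ B₀∈)))))
      where
      ⊆D′ : B₀ [ r ↦ p ] ⊆ D [ f ↦ c ]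
      ⊆D′ i∈ with ∈-swap⁻ i∈
      ... | inj₂ refl = ∈-swap⁺ p∈D (≢-sym f≢p)
      ... | inj₁ (i∈B₀ , i≢r) with rest i∈B₀ i≢r
      ...   | inj₁ refl = ∈-insertʳ
      ...   | inj₂ refl = ∈-swap⁺ b∈D (≢-sym f≢b)

    through : ∀ {D} → D ∈F 𝓑 → b ∈ D → p ∈ D → B₀ [ a ↦ p ] ∈F 𝓑
    through {D} D∈ b∈D p∈D with third (size3 D D∈) b∈D p∈D (λ { refl → p∉B₀ b∈B₀ })
    ... | f , f∈D , f≢b , f≢p with augment exch D∈ B₀∈ f∈D
    ... | c , c∈B₀ , D′∈ with B₀-points c∈B₀
    ...   | inj₁ refl        = contradiction (fits D′∈ b∈D p∈D f≢b f≢p q∈B₀ rest-without-q) q-blocked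
    ...   | inj₂ (inj₁ refl) = fits D′∈ b∈D p∈D f≢b f≢p a∈B₀ rest-without-a
    ...   | inj₂ (inj₂ refl) = contradiction three≡four λ ()
      where
      -- c = b is already in D - f, so D[f ↦ b] = D - f has only two points.
      three≡four : 3 ≡ 4
      three≡four = begin
        3                   ≡⟨ size3 D D∈ ⟨
        ∣ D ∣               ≡⟨ size-remove f∈D ⟩
        suc ∣ D - f ∣       ≡⟨ cong (suc ∘′ ∣_∣) (insert-present (x∈p∧x≢y⇒x∈p-y b∈D (≢-sym f≢b))) ⟨
        suc ∣ D [ f ↦ b ] ∣ ≡⟨ cong suc (size3 _ D′∈) ⟩
        4                   ∎
        where open ≡-Reasoning

  module LineFacet (simple : Simple 𝓑) (connected : Connected 𝓑) (rank-E : IsRank 𝓑 ⊤ 3)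
    {B₀ q t} (B₀∈ : B₀ ∈F 𝓑) (q∈B₀ : q ∈ B₀) (t∉B₀ : t ∉ B₀) (t∈L : t ∈ line 𝓑 (B₀ - q)) where

    S : Subset n
    S = B₀ - q

    L : Subset n
    L = line 𝓑 S

    ∣S∣≡2 : ∣ S ∣ ≡ 2
    ∣S∣≡2 = suc-injective (trans (sym (size-remove q∈B₀)) (size3 B₀ B₀∈))

    S⊆L : S ⊆ L
    S⊆L = ⊆line-removed B₀∈ q∈B₀

    q∉L : q ∉ L
    q∉L = removed∉line B₀∈ q∈B₀

    ∣B₀∩L∣≡2 : ∣ B₀ ∩ L ∣ ≡ 2
    ∣B₀∩L∣≡2 = begin
      ∣ B₀ ∩ L ∣             ≡⟨ count-remove B₀ L q∈B₀ ⟩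
      ∣ S ∩ L ∣ + ind q L    ≡⟨ cong₂ _+_ (count-⊆ S⊆L) (∉⇒ind≡0 q∉L) ⟩
      ∣ S ∣ + 0              ≡⟨ +-identityʳ ∣ S ∣ ⟩
      ∣ S ∣                  ≡⟨ ∣S∣≡2 ⟩
      2                      ∎
      where open ≡-Reasoning

    -- No basis lies inside L: trading q out of B₀ towards it would put a point of L beside S.
    no-basis-in-L : ∀ {B} → B ∈F 𝓑 → ¬ B ⊆ L
    no-basis-in-L {B} B∈ B⊆L with exch B₀ B B₀∈ B∈ q q∈B₀ (λ q∈B → q∉L (B⊆L q∈B))
    ... | y , y∈B , _ , S+y∈𝓑 = ∈line⁻ (B⊆L y∈B) S+y∈𝓑

    rank-L : IsRank 𝓑 L 2
    rank-L = (B₀ , B₀∈ , trans (cong ∣_∣ (∩-comm L B₀)) ∣B₀∩L∣≡2) ,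
             λ B B∈ → subst (_≤ 2) (cong ∣_∣ (∩-comm B L)) (at-most-two B B∈)
      where
      at-most-two : ∀ B → B ∈F 𝓑 → ∣ B ∩ L ∣ ≤ 2
      at-most-two B B∈ with m≤n⇒m<n∨m≡n (subst (∣ B ∩ L ∣ ≤_) (size3 B B∈) (∣p∩q∣≤∣p∣ B L))
      ... | inj₁ ∣B∩L∣<3 = s≤s⁻¹ ∣B∩L∣<3
      ... | inj₂ ∣B∩L∣≡3 =
        ⊥-elim (no-basis-in-L B∈ (full-count⇒⊆ (≤-reflexive (trans (size3 B B∈) (sym ∣B∩L∣≡3)))))

    -- Not every basis meets L twice: otherwise r(L) + r(E ∖ L) = 2 + 1 = r(E) and L would
    -- separate the connected matroid.
    not-all-on-L : ¬ (∀ B → B ∈F 𝓑 → ∣ B ∩ L ∣ ≡ 2)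
    not-all-on-L all-on-L = connected L 2 1 3 (t , t∈L) (q , q∉L) rank-L rank-∁L rank-E refl
      where
      one-off-L : ∀ B → B ∈F 𝓑 → ∣ ∁ L ∩ B ∣ ≡ 1
      one-off-L B B∈ = +-cancelˡ-≡ 2 _ _ (begin
        2 + ∣ ∁ L ∩ B ∣          ≡⟨ cong₂ _+_ (all-on-L B B∈) (cong ∣_∣ (∩-comm B (∁ L))) ⟨
        ∣ B ∩ L ∣ + ∣ B ∩ ∁ L ∣  ≡⟨ count-split B L ⟩
        ∣ B ∣                    ≡⟨ size3 B B∈ ⟩
        3                        ∎)
        where open ≡-Reasoning
      rank-∁L : IsRank 𝓑 (∁ L) 1
      rank-∁L = (B₀ , B₀∈ , one-off-L B₀ B₀∈) , λ B B∈ → ≤-reflexive (one-off-L B B∈)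

    module _ (A : Subset n) (k : ℕ) (valid : ∀ B → B ∈F 𝓑 → ∣ B ∩ L ∣ ≡ 2 → ∣ B ∩ A ∣ ≡ k) where

      -- An exchange in B₀ between two points on the same side of L keeps |· ∩ L| = 2,
      -- hence |· ∩ A| = k, so A does not separate the two points.
      same-side : ∀ {x y} → x ∈ B₀ → y ∉ B₀ → ind x L ≡ ind y L → B₀ [ x ↦ y ] ∈F 𝓑 →
        ind x A ≡ ind y A
      same-side x∈B₀ y∉B₀ same-L B′∈ = count-kept⇒same B₀ A x∈B₀ y∉B₀
        (trans (valid _ B′∈ (trans (swap-keeps-count B₀ L x∈B₀ y∉B₀ same-L) ∣B₀∩L∣≡2))
               (sym (valid B₀ B₀∈ ∣B₀∩L∣≡2)))

      -- Every point off L can replace q in B₀, so A does not separate it from q.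
      off-L : ∀ {e} → e ∉ L → ind e A ≡ ind q A
      off-L {e} e∉L with e ≟ q
      ... | yes refl = refl
      ... | no  e≢q  = sym (same-side q∈B₀ e∉B₀ (trans (∉⇒ind≡0 q∉L) (sym (∉⇒ind≡0 e∉L))) (∉line⇒basis e∉L))
        where
        e∉B₀ : e ∉ B₀
        e∉B₀ e∈B₀ = e∉L (S⊆L (x∈p∧x≢y⇒x∈p-y e∈B₀ e≢q))

      -- Every point p ∈ L ∖ B₀ can replace any a ∈ S (by pivot), so A does not separate them.
      across : ∀ {a p} → a ∈ S → p ∈ L → p ∉ B₀ → ind a A ≡ ind p A
      across {a} {p} a∈S p∈L p∉B₀ = same-side a∈B₀ p∉B₀
        (trans (∈⇒ind≡1 (S⊆L a∈S)) (sym (∈⇒ind≡1 p∈L)))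
        (pivot simple B₀∈ a∈B₀ q∈B₀ a≢q p∉B₀ (∈line⁻ p∈L))
        where
        a∈B₀ : a ∈ B₀
        a∈B₀ = proj₁ (∈-remove⁻ a∈S)
        a≢q : a ≢ q
        a≢q = proj₂ (∈-remove⁻ a∈S)

      on-L : ∀ {i} → i ∈ L → ind i A ≡ ind t A
      on-L {i} i∈L with i ∈? B₀
      ... | yes i∈B₀ = across (x∈p∧x≢y⇒x∈p-y i∈B₀ λ { refl → q∉L i∈L }) t∈L t∉B₀
      ... | no  i∉B₀ with nonempty-by-size S ∣S∣≡2
      ...   | a , a∈S = trans (sym (across a∈S i∈L i∉B₀)) (across a∈S t∈L t∉B₀)

      L⊆A : t ∈ A → L ⊆ A
      L⊆A t∈A i∈L = same-ind-∈ (on-L i∈L) t∈A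

      ∁L⊆A : q ∈ A → ∁ L ⊆ A
      ∁L⊆A q∈A i∈∁L = same-ind-∈ (off-L (x∈∁p⇒x∉p i∈∁L)) q∈A

      A⊆L : q ∉ A → A ⊆ L
      A⊆L q∉A i∈A = x∉∁p⇒x∈p (λ i∈∁L → same-ind-∉ (off-L (x∈∁p⇒x∉p i∈∁L)) q∉A i∈A)

      A⊆∁L : t ∉ A → A ⊆ ∁ L
      A⊆∁L t∉A i∈A = x∉p⇒x∈∁p (λ i∈L → same-ind-∉ (on-L i∈L) t∉A i∈A)

      blocks : A ≡ ⊤ ⊎ A ≡ ⊥ ⊎ A ≡ L ⊎ A ≡ ∁ L
      blocks with t ∈? A | q ∈? A
      ... | yes t∈A | yes q∈A = inj₁ (⊆-antisym ⊆⊤ (λ {i} _ → ⊤⊆A i))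
        where
        ⊤⊆A : ∀ i → i ∈ A
        ⊤⊆A i with i ∈? L
        ... | yes i∈L = L⊆A t∈A i∈L
        ... | no  i∉L = ∁L⊆A q∈A (x∉p⇒x∈∁p i∉L)
      ... | no  t∉A | no  q∉A =
        inj₂ (inj₁ (⊆-antisym (λ i∈A → contradiction (A⊆L q∉A i∈A) (x∈∁p⇒x∉p (A⊆∁L t∉A i∈A))) ⊥⊆))
      ... | yes t∈A | no  q∉A = inj₂ (inj₂ (inj₁ (⊆-antisym (A⊆L q∉A) (L⊆A t∈A))))
      ... | no  t∉A | yes q∈A = inj₂ (inj₂ (inj₂ (⊆-antisym (A⊆∁L t∉A) (∁L⊆A q∈A))))

    uniform : ∀ {A k c} → ∣ B₀ ∩ A ∣ ≡ k → (∀ B → B ∈F 𝓑 → ∣ B ∩ A ∣ ≡ c) →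
      ∀ B → B ∈F 𝓑 → ∣ B ∩ A ∣ ≡ k
    uniform k-at-B₀ constant B B∈ = trans (constant B B∈) (trans (sym (constant B₀ B₀∈)) k-at-B₀)

    -- |B ∩ L| = 2 is rigid: for A ∈ {E, ∅} the equation holds on all bases, while for
    -- A ∈ {L, E ∖ L} it fixes |B ∩ L| (as |B ∩ L| + |B ∖ L| = 3).
    rigid : Rigid 𝓑 L 2
    rigid A k valid with valid B₀ B₀∈ ∣B₀∩L∣≡2 | blocks A k valid
    ... | k-at-B₀ | inj₁ refl = inj₁ (uniform k-at-B₀ λ B B∈ → trans (count-⊤ B) (size3 B B∈))
    ... | k-at-B₀ | inj₂ (inj₁ refl) = inj₁ (uniform k-at-B₀ λ B _ → count-⊥ B)
    ... | k-at-B₀ | inj₂ (inj₂ (inj₁ refl)) = inj₂ λ B _ ∣B∩L∣≡k →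
      trans ∣B∩L∣≡k (trans (sym k-at-B₀) ∣B₀∩L∣≡2)
    ... | k-at-B₀ | inj₂ (inj₂ (inj₂ refl)) = inj₂ λ B B∈ ∣B∖L∣≡k → +-cancelʳ-≡ k _ _ (begin
      ∣ B ∩ L ∣ + k              ≡⟨ cong (∣ B ∩ L ∣ +_) ∣B∖L∣≡k ⟨
      ∣ B ∩ L ∣ + ∣ B ∩ ∁ L ∣    ≡⟨ trans (count-split B L) (size3 B B∈) ⟩
      3                          ≡⟨ trans (count-split B₀ L) (size3 B₀ B₀∈) ⟨
      ∣ B₀ ∩ L ∣ + ∣ B₀ ∩ ∁ L ∣  ≡⟨ cong₂ _+_ ∣B₀∩L∣≡2 k-at-B₀ ⟩
      2 + k                      ∎)
      where open ≡-Reasoning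

    line-in-F2 : InF2 𝓑 L
    line-in-F2 = rank-L , facet-criterion 𝓑 L 2 rank-L not-all-on-L rigid

  twin-from-F2 : Simple 𝓑 → Connected 𝓑 → IsRank 𝓑 ⊤ 3 →
    ∀ {u v} → (∀ F → InF2 𝓑 F → u ∈ F → v ∈ F) → Twin 𝓑 u v
  twin-from-F2 simple connected rank-E same-F2 B∈ q∈B t∉B t∈L =
    same-F2 _ (LineFacet.line-in-F2 simple connected rank-E B∈ q∈B t∉B t∈L)

  -- If every line through v (as in Twin) contains u, then u ∈ B can be exchanged for v ∉ B:
  -- otherwise v would lie on the line through B - u, and with it u.
  trade : ∀ {u v} → Twin 𝓑 v u → ∀ {B} → B ∈F 𝓑 → u ∈ B → v ∉ B → B [ u ↦ v ] ∈F 𝓑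
  trade {u} {v} twin {B} B∈ u∈B v∉B with basis? 𝓑 (B [ u ↦ v ])
  ... | yes B′∈ = B′∈
  ... | no  B′∉ = contradiction (twin B∈ u∈B v∉B (∈line⁺ B′∉) (∈line⁺ B′∉)) (removed∉line B∈ u∈B)

  -- Suppose B₁[z ↦ v] is a basis and u ∈ B₁ - z is missing from B₂.  If every line through u
  -- contains v, then some w ∈ B₂ also replaces z, and B₁[z ↦ w] avoids v.  (Exchange u out of
  -- B₁[z ↦ v] towards B₂; if the resulting w failed, u and hence v would be on the line
  -- through B₁ - z.)
  avoid : ∀ {u v} → Twin 𝓑 u v → ∀ {B₁ B₂ z} → B₁ ∈F 𝓑 → B₂ ∈F 𝓑 → z ∈ B₁ → z ∉ B₂ →
    u ∈ B₁ - z → u ∉ B₂ → v ∉ B₁ → B₁ [ z ↦ v ] ∈F 𝓑 →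
    ∃[ w ] (w ∈ B₂ × w ∉ B₁ × B₁ [ z ↦ w ] ∈F 𝓑 × v ∉ B₁ [ z ↦ w ])
  avoid {u} {v} twin {B₁} {B₂} {z} B₁∈ B₂∈ z∈B₁ z∉B₂ u∈B₁-z u∉B₂ v∉B₁ B₁′∈
    with exch (B₁ [ z ↦ v ]) B₂ B₁′∈ B₂∈ u (∈-insertˡ u∈B₁-z) u∉B₂
  ... | w , w∈B₂ , w∉B₁′ , _ with ∉-swap⁻ w∉B₁′ (λ { refl → z∉B₂ w∈B₂ }) | basis? 𝓑 (B₁ [ z ↦ w ])
  ...   | w∉B₁ | yes B₁″∈ = w , w∈B₂ , w∉B₁ , B₁″∈ , ∉-swap v∉B₁ (λ { refl → w∉B₁′ ∈-insertʳ })
  ...   | w∉B₁ | no  B₁″∉ =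
    ⊥-elim (∈line⁻ (twin B₁∈ z∈B₁ w∉B₁ (∈line⁺ B₁″∉) (⊆line-removed B₁∈ z∈B₁ u∈B₁-z)) B₁′∈)

  module PairDecomposition {x y} (x≢y : x ≢ y) (twin-xy : Twin 𝓑 x y) (twin-yx : Twin 𝓑 y x) where

    P : Subset n
    P = ⁅ x ⁆ ∪ ⁅ y ⁆

    count-P : ∀ B → ∣ B ∩ P ∣ ≡ ind x B + ind y B
    count-P B = begin
      ∣ B ∩ P ∣                ≡⟨ cong ∣_∣ (∩-comm B P) ⟩
      ∣ P ∩ B ∣                ≡⟨ count-insert ⁅ x ⁆ B y (x≢y⇒x∉⁅y⁆ (≢-sym x≢y)) ⟩
      ∣ ⁅ x ⁆ ∩ B ∣ + ind y B  ≡⟨ cong (_+ ind y B) (count-singleton B x) ⟩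
      ind x B + ind y B        ∎
      where open ≡-Reasoning

    count-P-both : ∀ {B} → x ∈ B → y ∈ B → ∣ B ∩ P ∣ ≡ 2
    count-P-both {B} x∈B y∈B = trans (count-P B) (cong₂ _+_ (∈⇒ind≡1 x∈B) (∈⇒ind≡1 y∈B))

    count-P-none : ∀ {B} → x ∉ B → y ∉ B → ∣ B ∩ P ∣ ≡ 0
    count-P-none {B} x∉B y∉B = trans (count-P B) (cong₂ _+_ (∉⇒ind≡0 x∉B) (∉⇒ind≡0 y∉B))

    meets⇒≥ : ∀ {B} → x ∈ B ⊎ y ∈ B → B ∈F ⟨ P , 1 ⟩≥
    meets⇒≥ {B} meets = Equivalence.to T-≡ (≤⇒≤ᵇ (subst (1 ≤_) (sym (count-P B)) (one≤ meets)))
      where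
      one≤ : x ∈ B ⊎ y ∈ B → 1 ≤ ind x B + ind y B
      one≤ (inj₁ x∈B) rewrite ∈⇒ind≡1 x∈B = s≤s z≤n
      one≤ (inj₂ y∈B) rewrite ∈⇒ind≡1 y∈B = m≤n+m 1 (ind x B)

    ≥⇒meets : ∀ {B} → B ∈F ⟨ P , 1 ⟩≥ → x ∈ B ⊎ y ∈ B
    ≥⇒meets {B} B∈ with x ∈? B | y ∈? B
    ... | yes x∈B | _       = inj₁ x∈B
    ... | no  _   | yes y∈B = inj₂ y∈B
    ... | no  x∉B | no  y∉B = contradiction (subst (λ m → (1 ≤ᵇ m) ≡ true) (count-P-none x∉B y∉B) B∈) λ ()

    ¬both⇒≤ : ∀ {B} → ¬ (x ∈ B × y ∈ B) → B ∈F ⟨ P , 1 ⟩≤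
    ¬both⇒≤ {B} ¬both = Equivalence.to T-≡ (≤⇒≤ᵇ (subst (_≤ 1) (sym (count-P B)) at-most-one))
      where
      at-most-one : ind x B + ind y B ≤ 1
      at-most-one with x ∈? B | y ∈? B
      ... | yes x∈B | yes y∈B = contradiction (x∈B , y∈B) ¬both
      ... | yes x∈B | no  y∉B rewrite ∈⇒ind≡1 x∈B | ∉⇒ind≡0 y∉B = s≤s z≤n
      ... | no  x∉B | yes y∈B rewrite ∉⇒ind≡0 x∉B | ∈⇒ind≡1 y∈B = s≤s z≤n
      ... | no  x∉B | no  y∉B rewrite ∉⇒ind≡0 x∉B | ∉⇒ind≡0 y∉B = z≤n

    ≤⇒¬both : ∀ {B} → B ∈F ⟨ P , 1 ⟩≤ → ¬ (x ∈ B × y ∈ B)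
    ≤⇒¬both B∈ (x∈B , y∈B) = contradiction (subst (λ m → (m ≤ᵇ 1) ≡ true) (count-P-both x∈B y∈B) B∈) λ ()

    via-twin : ∀ {u v} → Twin 𝓑 v u → (∀ {B} → v ∈ B → B ∈F ⟨ P , 1 ⟩≥) →
      ∀ {B₁ B₂} → B₁ ∈F 𝓑 → u ∈ B₁ → v ∉ B₁ → v ∈ B₂ →
      ∃[ w ] (w ∈ B₂ × w ∉ B₁ × B₁ [ u ↦ w ] ∈F (𝓑 ⊓ ⟨ P , 1 ⟩≥))
    via-twin {u} {v} twin v-meets {B₁} B₁∈ u∈B₁ v∉B₁ v∈B₂ =
      v , v∈B₂ , v∉B₁ , ∧-intro (trade twin B₁∈ u∈B₁ v∉B₁) (v-meets {B₁ [ u ↦ v ]} ∈-insertʳ)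

    -- Exchange in 𝓑 ∩ (P,1)_≥.  If the plain exchange B₁[z ↦ w] misses P, then z was B₁'s only
    -- point of P, and B₂ contains the other point of P, which replaces z by via-twin.
    exchange≥ : Exchange (𝓑 ⊓ ⟨ P , 1 ⟩≥)
    exchange≥ B₁ B₂ B₁∈ B₂∈ z z∈B₁ z∉B₂
      with exch B₁ B₂ (∧-elimˡ B₁∈) (∧-elimˡ B₂∈) z z∈B₁ z∉B₂
    ... | w , w∈B₂ , w∉B₁ , B₁′∈ with x ∈? B₁ [ z ↦ w ] | y ∈? B₁ [ z ↦ w ]
    ... | yes x∈B₁′ | _         = w , w∈B₂ , w∉B₁ , ∧-intro B₁′∈ (meets⇒≥ (inj₁ x∈B₁′))
    ... | no  _     | yes y∈B₁′ = w , w∈B₂ , w∉B₁ , ∧-intro B₁′∈ (meets⇒≥ (inj₂ y∈B₁′))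
    ... | no  x∉B₁′ | no  y∉B₁′ with ≥⇒meets (∧-elimʳ B₁∈)
    ...   | inj₁ x∈B₁ = via-twin (subst (Twin 𝓑 y) x≡z twin-yx) (λ y∈ → meets⇒≥ (inj₂ y∈))
              (∧-elimˡ B₁∈) z∈B₁ y∉B₁ (resolve x∉B₂ (≥⇒meets (∧-elimʳ B₂∈)))
      where
      x≡z : x ≡ z
      x≡z = left-out x∈B₁ x∉B₁′
      x∉B₂ : x ∉ B₂
      x∉B₂ x∈B₂ = z∉B₂ (subst (_∈ B₂) x≡z x∈B₂)
      y∉B₁ : y ∉ B₁
      y∉B₁ y∈B₁ = x≢y (trans x≡z (sym (left-out y∈B₁ y∉B₁′)))
    ...   | inj₂ y∈B₁ = via-twin (subst (Twin 𝓑 x) y≡z twin-xy) (λ x∈ → meets⇒≥ (inj₁ x∈))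
              (∧-elimˡ B₁∈) z∈B₁ x∉B₁ (resolve′ y∉B₂ (≥⇒meets (∧-elimʳ B₂∈)))
      where
      y≡z : y ≡ z
      y≡z = left-out y∈B₁ y∉B₁′
      y∉B₂ : y ∉ B₂
      y∉B₂ y∈B₂ = z∉B₂ (subst (_∈ B₂) y≡z y∈B₂)
      x∉B₁ : x ∉ B₁
      x∉B₁ x∈B₁ = x≢y (trans (left-out x∈B₁ x∉B₁′) (sym y≡z))

    via-avoid : ∀ {u v} → Twin 𝓑 u v → (∀ {B} → v ∉ B → ¬ (x ∈ B × y ∈ B)) →
      ∀ {B₁ B₂ z} → B₁ ∈F 𝓑 → B₂ ∈F 𝓑 → z ∈ B₁ → z ∉ B₂ → u ∈ B₁ - z → u ∉ B₂ → v ∉ B₁ →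
      B₁ [ z ↦ v ] ∈F 𝓑 → ∃[ w ] (w ∈ B₂ × w ∉ B₁ × B₁ [ z ↦ w ] ∈F (𝓑 ⊓ ⟨ P , 1 ⟩≤))
    via-avoid twin v-lacking B₁∈ B₂∈ z∈B₁ z∉B₂ u∈B₁-z u∉B₂ v∉B₁ B₁′∈
      with avoid twin B₁∈ B₂∈ z∈B₁ z∉B₂ u∈B₁-z u∉B₂ v∉B₁ B₁′∈
    ... | w , w∈B₂ , w∉B₁ , B₁″∈ , v∉B₁″ = w , w∈B₂ , w∉B₁ , ∧-intro B₁″∈ (¬both⇒≤ (v-lacking v∉B₁″))

    -- Exchange in 𝓑 ∩ (P,1)_≤.  If the plain exchange B₁[z ↦ w] contains all of P, then w is
    -- one point of P and the other lies in B₁ - z; via-avoid repairs this.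
    exchange≤ : Exchange (𝓑 ⊓ ⟨ P , 1 ⟩≤)
    exchange≤ B₁ B₂ B₁∈ B₂∈ z z∈B₁ z∉B₂
      with exch B₁ B₂ (∧-elimˡ B₁∈) (∧-elimˡ B₂∈) z z∈B₁ z∉B₂
    ... | w , w∈B₂ , w∉B₁ , B₁′∈ with x ∈? B₁ [ z ↦ w ] | y ∈? B₁ [ z ↦ w ]
    ... | no  x∉B₁′ | _         = w , w∈B₂ , w∉B₁ , ∧-intro B₁′∈ (¬both⇒≤ (x∉B₁′ ∘′ proj₁))
    ... | yes _     | no  y∉B₁′ = w , w∈B₂ , w∉B₁ , ∧-intro B₁′∈ (¬both⇒≤ (y∉B₁′ ∘′ proj₂))
    ... | yes x∈B₁′ | yes y∈B₁′ with ∈-swap⁻ x∈B₁′ | ∈-swap⁻ y∈B₁′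
    ...   | inj₁ (x∈B₁ , _) | inj₁ (y∈B₁ , _) = ⊥-elim (≤⇒¬both (∧-elimʳ B₁∈) (x∈B₁ , y∈B₁))
    ...   | inj₂ x≡w | inj₂ y≡w = ⊥-elim (x≢y (trans x≡w (sym y≡w)))
    ...   | inj₁ (x∈B₁ , x≢z) | inj₂ refl =
      via-avoid twin-xy (λ y∉ both → y∉ (proj₂ both)) (∧-elimˡ B₁∈) (∧-elimˡ B₂∈) z∈B₁ z∉B₂
        (x∈p∧x≢y⇒x∈p-y x∈B₁ x≢z) (λ x∈B₂ → ≤⇒¬both (∧-elimʳ B₂∈) (x∈B₂ , w∈B₂)) w∉B₁ B₁′∈
    ...   | inj₂ refl | inj₁ (y∈B₁ , y≢z) =
      via-avoid twin-yx (λ x∉ both → x∉ (proj₁ both)) (∧-elimˡ B₁∈) (∧-elimˡ B₂∈) z∈B₁ z∉B₂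
        (x∈p∧x≢y⇒x∈p-y y∈B₁ y≢z) (λ y∈B₂ → ≤⇒¬both (∧-elimʳ B₂∈) (w∈B₂ , y∈B₂)) w∉B₁ B₁′∈

    -- 𝓑 is 2-decomposable by (P,1)_=: both halves satisfy the exchange axiom, a basis
    -- through x and y (simplicity) lies above the hyperplane and one avoiding P below it.
    decomposition : Simple 𝓑 → IsRank 𝓑 (∁ P) 3 → TwoDecomposable 𝓑 P 1
    decomposition simple ((B₋ , B₋∈ , ∣∁P∩B₋∣≡3) , _) with simple x y
    ... | B₊ , B₊∈ , P⊆B₊ =
      ((B₊ , ∧-intro B₊∈ (meets⇒≥ (inj₁ x∈B₊))) , exchange≥) ,
      ((B₋ , ∧-intro B₋∈ (subst (λ m → (m ≤ᵇ 1) ≡ true) (sym ∣B₋∩P∣≡0) refl)) , exchange≤) ,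
      (B₊ , ∧-intro B₊∈ (subst (λ m → (1 <ᵇ m) ≡ true) (sym (count-P-both x∈B₊ y∈B₊)) refl)) ,
      (B₋ , ∧-intro B₋∈ (subst (λ m → (m <ᵇ 1) ≡ true) (sym ∣B₋∩P∣≡0) refl))
      where
      x∈B₊ : x ∈ B₊
      x∈B₊ = P⊆B₊ x ∈-pairˡ
      y∈B₊ : y ∈ B₊
      y∈B₊ = P⊆B₊ y ∈-pairʳ
      ∣B₋∩P∣≡0 : ∣ B₋ ∩ P ∣ ≡ 0
      ∣B₋∩P∣≡0 = +-cancelʳ-≡ 3 _ _ (begin
        ∣ B₋ ∩ P ∣ + 3            ≡⟨ cong (∣ B₋ ∩ P ∣ +_) (trans (cong ∣_∣ (∩-comm B₋ (∁ P))) ∣∁P∩B₋∣≡3) ⟨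
        ∣ B₋ ∩ P ∣ + ∣ B₋ ∩ ∁ P ∣  ≡⟨ count-split B₋ P ⟩
        ∣ B₋ ∣                    ≡⟨ size3 B₋ B₋∈ ⟩
        3                         ∎)
        where open ≡-Reasoning

corollary4p7 : (n : ℕ) (𝓑 : Fam n) → IsBaseFamily 𝓑 →
    Connected 𝓑 → Simple 𝓑 → IsRank 𝓑 ⊤ 3 →
    (x y : Fin n) → x ≢ y →
    (∀ F → InF2 𝓑 F → (x ∈ F → y ∈ F) × (y ∈ F → x ∈ F)) →
    IsRank 𝓑 (∁ (⁅ x ⁆ ∪ ⁅ y ⁆)) 3 →
    TwoDecomposable 𝓑 (⁅ x ⁆ ∪ ⁅ y ⁆) 1
corollary4p7 n 𝓑 (_ , exch) connected simple rank-E x y x≢y same-lines rank-off-P =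
  PairDecomposition.decomposition x≢y twin-xy twin-yx simple rank-off-P
  where
  size3 : ∀ B → B ∈F 𝓑 → ∣ B ∣ ≡ 3
  size3 = basis-size exch rank-E
  open Rank3 𝓑 exch size3
  twin-xy : Twin 𝓑 x y
  twin-xy = twin-from-F2 simple connected rank-E (λ F F∈ → proj₁ (same-lines F F∈))
  twin-yx : Twin 𝓑 y x
  twin-yx = twin-from-F2 simple connected rank-E (λ F F∈ → proj₂ (same-lines F F∈))
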